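{- Let $\alpha,\beta,\gamma$ be distinct stack variables, let $U := \mu\gamma.\,\mathsf{car}(\alpha)\star\alpha$ and let $W[\cdot]$ be the context $$W[\cdot] := \mu\alpha.\,\mathsf{car}(\alpha)\star\big((\mu\beta.\,\mathsf{car}(\alpha)\star U::[\cdot]::\alpha)::U::\alpha\big).$$ Then for all terms $M,N$ of the stack calculus we have $W[M]\simeq W[N]$.
   Context: The stack calculus. Fix a countably infinite set of stack variables $\alpha,\beta,\gamma,\ldots$. Expressions are generated by: stacks $\pi ::= \mathsf{nil}\mid\alpha\mid\mathsf{cdr}(\pi)\mid M::\pi$; terms $M ::= \mathsf{car}(\pi)\mid \mu\alpha.P$; processes $P ::= M\star\pi$. The operator $::$ associates to the right and binds more tightly than $\star$ (so $M\star N::\pi$ means $M\star(N::\pi)$). $\mu\alpha$ binds $\alpha$; $E\{\pi/\alpha\}$ denotes capture-avoiding substitution of the stack $\pi$ for the free occurrences of $\alpha$ in $E$. Reduction rules: $(\mu\alpha.P)\star\pi\to P\{\pi/\alpha\}$, $\mathsf{car}(M::\pi)\to M$, $\mathsf{cdr}(M::\pi)\to\pi$; $\to_s$ is their contextual closure, $\twoheadrightarrow_s$ its reflexive-transitive closure and $=_s$ its equivalence closure. Write $\mathsf{cdr}^n(\pi)$ for $n$-fold application of $\mathsf{cdr}$ and $\mathsf{car}_n(\pi):=\mathsf{car}(\mathsf{cdr}^n(\pi))$. Every expression has a unique normal form with respect to the $\mathsf{car}$ and $\mathsf{cdr}$ rules alone, its canonical form. Outer reduction (deterministic, no contextual closure):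 $M\to_o \mu\alpha.P\{\pi/\beta\}$ if $\mu\alpha.(\mu\beta.P)\star\pi$ is the canonical form of $M$. A term is an outer normal form (onf) if it is not $\to_o$-reducible; such terms are exactly those of shape $\mu\alpha.H\star N_1::\cdots::N_m::\tau$ with $H$ either $\mathsf{car}_n(\beta)$ (the onf is proper) or $\mathsf{car}_n(\mathsf{nil})$ (improper), and $\tau$ either $\mathsf{cdr}^k(\gamma)$ or $\mathsf{cdr}^k(\mathsf{nil})$. A term has a proper onf if it $\to_o$-reduces in finitely many steps to a proper onf. Head contexts are generated by $C[\cdot]::=[\cdot]\mid \mu\alpha.C[\cdot]\star\pi$ (filling the hole may capture variables). Two terms are operationally equivalent, $M\simeq N$, if for every head context $C[\cdot]$, $C[M]$ has a proper onf iff $C[N]$ has a proper onf. -}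

module Defs where

open import Data.Nat using (ℕ; zero; suc)
open import Data.Product using (Σ; ∃; _×_; _,_)
open import Relation.Binary.PropositionalEquality using (_≡_)
open import Relation.Binary.Construct.Closure.ReflexiveTransitive using (Star)
open import Function.Bundles using (_⇔_)

-- Syntax of the stack calculus, with de Bruijn indices for stack
-- variables (var 0 is the innermost enclosing μ-binder).

infixr 5 _∷_
infix  4 _⋆_

mutual
  data Stack : Set where
    nil : Stack
    var : ℕ → Stack
    cdr : Stack → Stack
    _∷_ : Term → Stack → Stack

  data Term : Set where
    car : Stack → Term
    μ   : Proc → Term

  data Proc : Set where
    _⋆_ : Term → Stack → Proc

liftRen : (ℕ → ℕ) → ℕ → ℕ
liftRen ρ zero    = zero
liftRen ρ (suc n) = suc (ρ n)

mutual
  renS : (ℕ → ℕ) → Stack → Stack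
  renS ρ nil       = nil
  renS ρ (var n)   = var (ρ n)
  renS ρ (cdr π)   = cdr (renS ρ π)
  renS ρ (M ∷ π)   = renT ρ M ∷ renS ρ π

  renT : (ℕ → ℕ) → Term → Term
  renT ρ (car π) = car (renS ρ π)
  renT ρ (μ P)   = μ (renP (liftRen ρ) P)

  renP : (ℕ → ℕ) → Proc → Proc
  renP ρ (M ⋆ π) = renT ρ M ⋆ renS ρ π

liftSub : (ℕ → Stack) → ℕ → Stack
liftSub σ zero    = var zero
liftSub σ (suc n) = renS suc (σ n)

mutual
  subS : (ℕ → Stack) → Stack → Stack
  subS σ nil     = nil
  subS σ (var n) = σ n
  subS σ (cdr π) = cdr (subS σ π)
  subS σ (M ∷ π) = subT σ M ∷ subS σ π

  subT : (ℕ → Stack) → Term → Term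
  subT σ (car π) = car (subS σ π)
  subT σ (μ P)   = μ (subP (liftSub σ) P)

  subP : (ℕ → Stack) → Proc → Proc
  subP σ (M ⋆ π) = subT σ M ⋆ subS σ π

-- single substitution  P{π/var 0}  (remaining free variables shift down)
single : Stack → ℕ → Stack
single π zero    = π
single π (suc n) = var n

_[_]P : Proc → Stack → Proc
P [ π ]P = subP (single π) P

-- Canonical forms: normal forms w.r.t. car(M∷π) → M, cdr(M∷π) → π

mutual
  canS : Stack → Stack
  canS nil     = nil
  canS (var n) = var n
  canS (cdr π) = cdrC (canS π)
  canS (M ∷ π) = canT M ∷ canS π

  canT : Term → Term
  canT (car π) = carC (canS π)
  canT (μ P)   = μ (canP P)

  canP : Proc → Proc
  canP (M ⋆ π) = canT M ⋆ canS π

  cdrC : Stack → Stack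
  cdrC (M ∷ π) = π
  cdrC π       = cdr π

  carC : Stack → Term
  carC (M ∷ π) = M
  carC π       = car π

cdr^ : ℕ → Stack → Stack
cdr^ zero    π = π
cdr^ (suc n) π = cdr (cdr^ n π)

-- Outer reduction:  M →o μα.P{π/β}  if  μα.(μβ.P)⋆π  is the canonical form of M

data _→o_ : Term → Term → Set where
  outer : ∀ {M P π} → canT M ≡ μ (μ P ⋆ π) → M →o μ (P [ π ]P)

_→o*_ : Term → Term → Set
_→o*_ = Star _→o_

ProperOnf : Term → Set
ProperOnf M = Σ ℕ λ n → Σ ℕ λ x → Σ Stack λ ρ →
  canT M ≡ μ (car (cdr^ n (var x)) ⋆ ρ)

HasProperOnf : Term → Set
HasProperOnf M = ∃ λ M' → (M →o* M') × ProperOnf M'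

-- Head contexts  C ::= [·] | μα.C ⋆ π   (plugging captures: no shifting)

data HCtx : Set where
  hole : HCtx
  mu   : HCtx → Stack → HCtx

plug : HCtx → Term → Term
plug hole    M = M
plug (mu C π) M = μ (plug C M ⋆ π)

_≃op_ : Term → Term → Set
M ≃op N = (C : HCtx) → HasProperOnf (plug C M) ⇔ HasProperOnf (plug C N)

-- The context W[·].
--   U := μγ. car(α) ⋆ α
--   W[X] := μα. car(α) ⋆ ((μβ. car(α) ⋆ U ∷ X ∷ α) ∷ U ∷ α)
-- U at binder depth d (α is index d-1 outside U, so index d inside μγ):
Uat : ℕ → Term
Uat d = μ (car (var d) ⋆ var d)

-- X is placed under μα μβ without shifting: var 0 = β, var 1 = α in X (capture).
W : Term → Term
W X = μ (car (var 0) ⋆ (μ (car (var 1) ⋆ Uat 2 ∷ X ∷ var 1)) ∷ Uat 1 ∷ var 0)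

module Submission where

-- W[M] ≃ W[N]: the argument of W never decides whether a proper onf is reached.
--
-- Under a head context μδ.[·]⋆π, W[X] steps (up to canonical forms) to the
-- process  car(π) ⋆ B_X :: U :: π,  the instance of the generic process
-- G = car(π) ⋆ car(s₁) :: car(s₂) :: π  whose slot variables s₁, s₂ hold the
-- singleton stacks B_X::nil and U::nil.  Outer reduction commutes with
-- substitution, so G can be run symbolically until its head is a neutral stack.
-- Head s₂ = U always reduces to μδ.car(π)⋆π.  Head s₁ = B_X rebuilds G with slots
-- (U, X'); replaying the same run then ends on s₁ = U.  Any other head yields an
-- onf (proper, or improper hence excluded) that does not involve X.  Deeper head
-- contexts first substitute into W[X], which keeps the shape W[X'].

open import Defs
open import Data.Nat using (ℕ; zero; suc)
open import Data.Product using (Σ; _×_; _,_; proj₂)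
open import Data.Empty using (⊥; ⊥-elim)
open import Relation.Binary.PropositionalEquality
open import Relation.Binary.Construct.Closure.ReflexiveTransitive using (Star; ε; _◅_; _◅◅_)
open import Function.Bundles using (mk⇔)

liftRen-cong : ∀ {ρ ρ'} → ρ ≗ ρ' → liftRen ρ ≗ liftRen ρ'
liftRen-cong e zero    = refl
liftRen-cong e (suc n) = cong suc (e n)

mutual
  renS-cong : ∀ {ρ ρ'} → ρ ≗ ρ' → ∀ π → renS ρ π ≡ renS ρ' π
  renS-cong e nil     = refl
  renS-cong e (var n) = cong var (e n)
  renS-cong e (cdr π) = cong cdr (renS-cong e π)
  renS-cong e (M ∷ π) = cong₂ _∷_ (renT-cong e M) (renS-cong e π)

  renT-cong : ∀ {ρ ρ'} → ρ ≗ ρ' → ∀ M → renT ρ M ≡ renT ρ' M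
  renT-cong e (car π) = cong car (renS-cong e π)
  renT-cong e (μ P)   = cong μ (renP-cong (liftRen-cong e) P)

  renP-cong : ∀ {ρ ρ'} → ρ ≗ ρ' → ∀ P → renP ρ P ≡ renP ρ' P
  renP-cong e (M ⋆ π) = cong₂ _⋆_ (renT-cong e M) (renS-cong e π)

liftSub-cong : ∀ {σ τ} → σ ≗ τ → liftSub σ ≗ liftSub τ
liftSub-cong e zero    = refl
liftSub-cong e (suc n) = cong (renS suc) (e n)

mutual
  subS-cong : ∀ {σ τ} → σ ≗ τ → ∀ π → subS σ π ≡ subS τ π
  subS-cong e nil     = refl
  subS-cong e (var n) = e n
  subS-cong e (cdr π) = cong cdr (subS-cong e π)
  subS-cong e (M ∷ π) = cong₂ _∷_ (subT-cong e M) (subS-cong e π)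

  subT-cong : ∀ {σ τ} → σ ≗ τ → ∀ M → subT σ M ≡ subT τ M
  subT-cong e (car π) = cong car (subS-cong e π)
  subT-cong e (μ P)   = cong μ (subP-cong (liftSub-cong e) P)

  subP-cong : ∀ {σ τ} → σ ≗ τ → ∀ P → subP σ P ≡ subP τ P
  subP-cong e (M ⋆ π) = cong₂ _⋆_ (subT-cong e M) (subS-cong e π)

liftSub-var : liftSub var ≗ var
liftSub-var zero    = refl
liftSub-var (suc n) = refl

mutual
  subS-id : ∀ π → subS var π ≡ π
  subS-id nil     = refl
  subS-id (var n) = refl
  subS-id (cdr π) = cong cdr (subS-id π)
  subS-id (M ∷ π) = cong₂ _∷_ (subT-id M) (subS-id π)

  subT-id : ∀ M → subT var M ≡ M
  subT-id (car π) = cong car (subS-id π)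
  subT-id (μ P)   = cong μ (trans (subP-cong liftSub-var P) (subP-id P))

  subP-id : ∀ P → subP var P ≡ P
  subP-id (M ⋆ π) = cong₂ _⋆_ (subT-id M) (subS-id π)

mutual
  renS-renS : ∀ ρ ρ' π → renS ρ (renS ρ' π) ≡ renS (λ n → ρ (ρ' n)) π
  renS-renS ρ ρ' nil     = refl
  renS-renS ρ ρ' (var n) = refl
  renS-renS ρ ρ' (cdr π) = cong cdr (renS-renS ρ ρ' π)
  renS-renS ρ ρ' (M ∷ π) = cong₂ _∷_ (renT-renT ρ ρ' M) (renS-renS ρ ρ' π)

  renT-renT : ∀ ρ ρ' M → renT ρ (renT ρ' M) ≡ renT (λ n → ρ (ρ' n)) M
  renT-renT ρ ρ' (car π) = cong car (renS-renS ρ ρ' π)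
  renT-renT ρ ρ' (μ P)   = cong μ (trans (renP-renP (liftRen ρ) (liftRen ρ') P)
                                         (renP-cong (λ { zero → refl ; (suc n) → refl }) P))

  renP-renP : ∀ ρ ρ' P → renP ρ (renP ρ' P) ≡ renP (λ n → ρ (ρ' n)) P
  renP-renP ρ ρ' (M ⋆ π) = cong₂ _⋆_ (renT-renT ρ ρ' M) (renS-renS ρ ρ' π)

mutual
  subS-renS : ∀ σ ρ π → subS σ (renS ρ π) ≡ subS (λ n → σ (ρ n)) π
  subS-renS σ ρ nil     = refl
  subS-renS σ ρ (var n) = refl
  subS-renS σ ρ (cdr π) = cong cdr (subS-renS σ ρ π)
  subS-renS σ ρ (M ∷ π) = cong₂ _∷_ (subT-renT σ ρ M) (subS-renS σ ρ π)

  subT-renT : ∀ σ ρ M → subT σ (renT ρ M) ≡ subT (λ n → σ (ρ n)) M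
  subT-renT σ ρ (car π) = cong car (subS-renS σ ρ π)
  subT-renT σ ρ (μ P)   = cong μ (trans (subP-renP (liftSub σ) (liftRen ρ) P)
                                         (subP-cong (λ { zero → refl ; (suc n) → refl }) P))

  subP-renP : ∀ σ ρ P → subP σ (renP ρ P) ≡ subP (λ n → σ (ρ n)) P
  subP-renP σ ρ (M ⋆ π) = cong₂ _⋆_ (subT-renT σ ρ M) (subS-renS σ ρ π)

mutual
  renS-subS : ∀ ρ σ π → renS ρ (subS σ π) ≡ subS (λ n → renS ρ (σ n)) π
  renS-subS ρ σ nil     = refl
  renS-subS ρ σ (var n) = refl
  renS-subS ρ σ (cdr π) = cong cdr (renS-subS ρ σ π)
  renS-subS ρ σ (M ∷ π) = cong₂ _∷_ (renT-subT ρ σ M) (renS-subS ρ σ π)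

  renT-subT : ∀ ρ σ M → renT ρ (subT σ M) ≡ subT (λ n → renS ρ (σ n)) M
  renT-subT ρ σ (car π) = cong car (renS-subS ρ σ π)
  renT-subT ρ σ (μ P)   = cong μ (trans (renP-subP (liftRen ρ) (liftSub σ) P)
                                         (subP-cong lifted P))
    where
    lifted : (λ n → renS (liftRen ρ) (liftSub σ n)) ≗ liftSub (λ n → renS ρ (σ n))
    lifted zero    = refl
    lifted (suc n) = trans (renS-renS (liftRen ρ) suc (σ n)) (sym (renS-renS suc ρ (σ n)))

  renP-subP : ∀ ρ σ P → renP ρ (subP σ P) ≡ subP (λ n → renS ρ (σ n)) P
  renP-subP ρ σ (M ⋆ π) = cong₂ _⋆_ (renT-subT ρ σ M) (renS-subS ρ σ π)

mutual
  subS-subS : ∀ σ τ π → subS σ (subS τ π) ≡ subS (λ n → subS σ (τ n)) π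
  subS-subS σ τ nil     = refl
  subS-subS σ τ (var n) = refl
  subS-subS σ τ (cdr π) = cong cdr (subS-subS σ τ π)
  subS-subS σ τ (M ∷ π) = cong₂ _∷_ (subT-subT σ τ M) (subS-subS σ τ π)

  subT-subT : ∀ σ τ M → subT σ (subT τ M) ≡ subT (λ n → subS σ (τ n)) M
  subT-subT σ τ (car π) = cong car (subS-subS σ τ π)
  subT-subT σ τ (μ P)   = cong μ (trans (subP-subP (liftSub σ) (liftSub τ) P)
                                         (subP-cong lifted P))
    where
    lifted : (λ n → subS (liftSub σ) (liftSub τ n)) ≗ liftSub (λ n → subS σ (τ n))
    lifted zero    = refl
    lifted (suc n) = trans (subS-renS (liftSub σ) suc (τ n)) (sym (renS-subS suc σ (τ n)))

  subP-subP : ∀ σ τ P → subP σ (subP τ P) ≡ subP (λ n → subS σ (τ n)) P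
  subP-subP σ τ (M ⋆ π) = cong₂ _⋆_ (subT-subT σ τ M) (subS-subS σ τ π)

single-weaken : ∀ π σ → subS (single π) (renS suc σ) ≡ σ
single-weaken π σ = trans (subS-renS (single π) suc σ) (subS-id σ)

subP-single : ∀ σ π Q → subP σ (subP (single π) Q) ≡ subP (single (subS σ π)) (subP (liftSub σ) Q)
subP-single σ π Q = trans (subP-subP σ (single π) Q)
  (trans (subP-cong pointwise Q) (sym (subP-subP (single (subS σ π)) (liftSub σ) Q)))
  where
  pointwise : (λ n → subS σ (single π n)) ≗ (λ n → subS (single (subS σ π)) (liftSub σ n))
  pointwise zero    = refl
  pointwise (suc n) = sym (single-weaken (subS σ π) (σ n))

subS-by-vars : ∀ ρ π → subS (λ n → var (ρ n)) π ≡ renS ρ π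
subS-by-vars ρ π = trans (sym (renS-subS ρ var π)) (cong (renS ρ) (subS-id π))

renS-cdrC : ∀ ρ σ → renS ρ (cdrC σ) ≡ cdrC (renS ρ σ)
renS-cdrC ρ nil     = refl
renS-cdrC ρ (var n) = refl
renS-cdrC ρ (cdr σ) = refl
renS-cdrC ρ (M ∷ σ) = refl

renT-carC : ∀ ρ σ → renT ρ (carC σ) ≡ carC (renS ρ σ)
renT-carC ρ nil     = refl
renT-carC ρ (var n) = refl
renT-carC ρ (cdr σ) = refl
renT-carC ρ (M ∷ σ) = refl

mutual
  canS-renS : ∀ ρ π → canS (renS ρ π) ≡ renS ρ (canS π)
  canS-renS ρ nil     = refl
  canS-renS ρ (var n) = refl
  canS-renS ρ (cdr π) = trans (cong cdrC (canS-renS ρ π)) (sym (renS-cdrC ρ (canS π)))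
  canS-renS ρ (M ∷ π) = cong₂ _∷_ (canT-renT ρ M) (canS-renS ρ π)

  canT-renT : ∀ ρ M → canT (renT ρ M) ≡ renT ρ (canT M)
  canT-renT ρ (car π) = trans (cong carC (canS-renS ρ π)) (sym (renT-carC ρ (canS π)))
  canT-renT ρ (μ P)   = cong μ (canP-renP (liftRen ρ) P)

  canP-renP : ∀ ρ P → canP (renP ρ P) ≡ renP ρ (canP P)
  canP-renP ρ (M ⋆ π) = cong₂ _⋆_ (canT-renT ρ M) (canS-renS ρ π)

canS-subS-cdrC : ∀ τ σ → canS (subS τ (cdrC σ)) ≡ cdrC (canS (subS τ σ))
canS-subS-cdrC τ nil     = refl
canS-subS-cdrC τ (var n) = refl
canS-subS-cdrC τ (cdr σ) = refl
canS-subS-cdrC τ (M ∷ σ) = refl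

canT-subT-carC : ∀ τ σ → canT (subT τ (carC σ)) ≡ carC (canS (subS τ σ))
canT-subT-carC τ nil     = refl
canT-subT-carC τ (var n) = refl
canT-subT-carC τ (cdr σ) = refl
canT-subT-carC τ (M ∷ σ) = refl

mutual
  canS-sub-can : ∀ τ π → canS (subS τ (canS π)) ≡ canS (subS τ π)
  canS-sub-can τ nil     = refl
  canS-sub-can τ (var n) = refl
  canS-sub-can τ (cdr π) = trans (canS-subS-cdrC τ (canS π)) (cong cdrC (canS-sub-can τ π))
  canS-sub-can τ (M ∷ π) = cong₂ _∷_ (canT-sub-can τ M) (canS-sub-can τ π)

  canT-sub-can : ∀ τ M → canT (subT τ (canT M)) ≡ canT (subT τ M)
  canT-sub-can τ (car π) = trans (canT-subT-carC τ (canS π)) (cong carC (canS-sub-can τ π))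
  canT-sub-can τ (μ P)   = cong μ (canP-sub-can (liftSub τ) P)

  canP-sub-can : ∀ τ P → canP (subP τ (canP P)) ≡ canP (subP τ P)
  canP-sub-can τ (M ⋆ π) = cong₂ _⋆_ (canT-sub-can τ M) (canS-sub-can τ π)

canS-idem : ∀ π → canS (canS π) ≡ canS π
canS-idem π = trans (cong canS (sym (subS-id (canS π))))
                    (trans (canS-sub-can var π) (cong canS (subS-id π)))

SameCan : (ℕ → Stack) → (ℕ → Stack) → Set
SameCan σ τ = ∀ n → canS (σ n) ≡ canS (τ n)

liftSub-sameCan : ∀ {σ τ} → SameCan σ τ → SameCan (liftSub σ) (liftSub τ)
liftSub-sameCan e zero = refl
liftSub-sameCan {σ} {τ} e (suc n) =
  trans (canS-renS suc (σ n)) (trans (cong (renS suc) (e n)) (sym (canS-renS suc (τ n))))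

mutual
  canS-sameCan : ∀ {σ τ} → SameCan σ τ → ∀ π → canS (subS σ π) ≡ canS (subS τ π)
  canS-sameCan e nil     = refl
  canS-sameCan e (var n) = e n
  canS-sameCan e (cdr π) = cong cdrC (canS-sameCan e π)
  canS-sameCan e (M ∷ π) = cong₂ _∷_ (canT-sameCan e M) (canS-sameCan e π)

  canT-sameCan : ∀ {σ τ} → SameCan σ τ → ∀ M → canT (subT σ M) ≡ canT (subT τ M)
  canT-sameCan e (car π) = cong carC (canS-sameCan e π)
  canT-sameCan e (μ P)   = cong μ (canP-sameCan (liftSub-sameCan e) P)

  canP-sameCan : ∀ {σ τ} → SameCan σ τ → ∀ P → canP (subP σ P) ≡ canP (subP τ P)
  canP-sameCan e (M ⋆ π) = cong₂ _⋆_ (canT-sameCan e M) (canS-sameCan e π)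

-- Neutral stacks  cdrⁿ(nil), cdrⁿ(α)  are the canonical stacks that are not a cons.
data Neutral : Stack → Set where
  ne-nil : Neutral nil
  ne-var : ∀ n → Neutral (var n)
  ne-cdr : ∀ {τ} → Neutral τ → Neutral (cdr τ)

data NeutralView : Stack → Set where
  cdrs-nil : ∀ k → NeutralView (cdr^ k nil)
  cdrs-var : ∀ k x → NeutralView (cdr^ k (var x))

neutralView : ∀ {τ} → Neutral τ → NeutralView τ
neutralView ne-nil     = cdrs-nil zero
neutralView (ne-var n) = cdrs-var zero n
neutralView (ne-cdr ne) with neutralView ne
... | cdrs-nil k   = cdrs-nil (suc k)
... | cdrs-var k x = cdrs-var (suc k) x

neutral-cdr^ : ∀ k {τ} → Neutral τ → Neutral (cdr^ k τ)
neutral-cdr^ zero    ne = ne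
neutral-cdr^ (suc k) ne = ne-cdr (neutral-cdr^ k ne)

cdrC-neutral : ∀ {τ} → Neutral τ → cdrC τ ≡ cdr τ
cdrC-neutral ne-nil     = refl
cdrC-neutral (ne-var n) = refl
cdrC-neutral (ne-cdr _) = refl

carC-neutral : ∀ {τ} → Neutral τ → carC τ ≡ car τ
carC-neutral ne-nil     = refl
carC-neutral (ne-var n) = refl
carC-neutral (ne-cdr _) = refl

canS-neutral : ∀ {τ} → Neutral τ → canS τ ≡ τ
canS-neutral ne-nil        = refl
canS-neutral (ne-var n)    = refl
canS-neutral (ne-cdr ne)    = trans (cong cdrC (canS-neutral ne)) (cdrC-neutral ne)

canS-cdr^-cons : ∀ k M π → canS (cdr^ (suc k) (M ∷ π)) ≡ canS (cdr^ k π)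
canS-cdr^-cons zero    M π = refl
canS-cdr^-cons (suc k) M π = cong cdrC (canS-cdr^-cons k M π)

data CanTerm : Term → Set where
  can-car : ∀ {τ} → Neutral τ → CanTerm (car τ)
  can-μ   : ∀ {P} → CanTerm (μ P)

data CanStack : Stack → Set where
  can-neutral : ∀ {τ} → Neutral τ → CanStack τ
  can-cons    : ∀ {M τ} → CanTerm M → CanStack τ → CanStack (M ∷ τ)

cdrC-canonical : ∀ {τ} → CanStack τ → CanStack (cdrC τ)
cdrC-canonical (can-neutral ne) rewrite cdrC-neutral ne = can-neutral (ne-cdr ne)
cdrC-canonical (can-cons _ c)   = c

carC-canonical : ∀ {τ} → CanStack τ → CanTerm (carC τ)
carC-canonical (can-neutral ne) rewrite carC-neutral ne = can-car ne
carC-canonical (can-cons c _)   = c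

mutual
  canS-canonical : ∀ π → CanStack (canS π)
  canS-canonical nil     = can-neutral ne-nil
  canS-canonical (var n) = can-neutral (ne-var n)
  canS-canonical (cdr π) = cdrC-canonical (canS-canonical π)
  canS-canonical (M ∷ π) = can-cons (canT-canonical M) (canS-canonical π)

  canT-canonical : ∀ M → CanTerm (canT M)
  canT-canonical (car π) = carC-canonical (canS-canonical π)
  canT-canonical (μ P)   = can-μ

→o-deterministic : ∀ {T U U'} → T →o U → T →o U' → U ≡ U'
→o-deterministic (outer e) (outer e') with trans (sym e) e'
... | refl = refl

proper-irreducible : ∀ {T U} → ProperOnf T → T →o U → ⊥
proper-irreducible (n , x , ρ , e) (outer e') with trans (sym e) e'
... | ()

-- T reaches a proper onf in exactly n outer steps.  The step count serves as
-- termination measure for the inductions below.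
data OnfIn : ℕ → Term → Set where
  done : ∀ {T} → ProperOnf T → OnfIn zero T
  step : ∀ {n T U} → T →o U → OnfIn n U → OnfIn (suc n) T

toOnfIn : ∀ {T} → HasProperOnf T → Σ ℕ λ n → OnfIn n T
toOnfIn (T' , ε , p) = zero , done p
toOnfIn (T' , s ◅ ss , p) with toOnfIn (T' , ss , p)
... | n , onf = suc n , step s onf

fromOnfIn : ∀ {n T} → OnfIn n T → HasProperOnf T
fromOnfIn (done p) = _ , ε , p
fromOnfIn (step s onf) with fromOnfIn onf
... | T' , ss , p = T' , s ◅ ss , p

-- By determinism, the budget is consumed along any outer reduction.
onfIn-step : ∀ {n T U} → OnfIn n T → T →o U → Σ ℕ λ m → OnfIn m U
onfIn-step (done p)      s = ⊥-elim (proper-irreducible p s)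
onfIn-step (step s' onf) s rewrite →o-deterministic s s' = _ , onf

onfIn-steps : ∀ {n T U} → OnfIn n T → T →o* U → Σ ℕ λ m → OnfIn m U
onfIn-steps onf ε = _ , onf
onfIn-steps onf (s ◅ ss) with onfIn-step onf s
... | m , onf' = onfIn-steps onf' ss

infix 4 _≈_ _↝_

_≈_ : Term → Term → Set
T ≈ U = canT T ≡ canT U

→o-resp-≈ : ∀ {T T' U} → T ≈ T' → T →o U → T' →o U
→o-resp-≈ eq (outer e) = outer (trans (sym eq) e)

proper-resp-≈ : ∀ {T T'} → T ≈ T' → ProperOnf T → ProperOnf T'
proper-resp-≈ eq (k , x , ρ , e) = k , x , ρ , trans (sym eq) e

onfIn-resp-≈ : ∀ {n T T'} → T ≈ T' → OnfIn n T → OnfIn n T'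
onfIn-resp-≈ {T = T} {T'} eq (done p) = done (proper-resp-≈ {T} {T'} eq p)
onfIn-resp-≈ eq (step s onf)        = step (→o-resp-≈ eq s) onf

data _↝_ (T U : Term) : Set where
  reach : ∀ {T'} → T →o* T' → T' ≈ U → T ↝ U

↝-refl : ∀ {T U} → T ≈ U → T ↝ U
↝-refl eq = reach ε eq

↝-step : ∀ {T U} → T →o U → T ↝ U
↝-step s = reach (s ◅ ε) refl

≈-then-steps : ∀ {T U V} → T ≈ U → U →o* V → T ↝ V
≈-then-steps eq ε        = reach ε eq
≈-then-steps eq (s ◅ ss) = reach (→o-resp-≈ (sym eq) s ◅ ss) refl

↝-trans : ∀ {T U V} → T ↝ U → U ↝ V → T ↝ V
↝-trans (reach ss e) (reach ss' e') with ≈-then-steps e ss'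
... | reach ss'' e'' = reach (ss ◅◅ ss'') (trans e'' e')

onfIn-↝ : ∀ {n T U} → OnfIn n T → T ↝ U → Σ ℕ λ m → OnfIn m U
onfIn-↝ onf (reach ss e) with onfIn-steps onf ss
... | m , onf' = m , onfIn-resp-≈ e onf'

hasProperOnf-↝ : ∀ {T U} → T ↝ U → HasProperOnf U → HasProperOnf T
hasProperOnf-↝ (reach ss e) (V , ss' , p) with ≈-then-steps e ss'
... | reach {T'} ss'' e'' = T' , ss ◅◅ ss'' , proper-resp-≈ {V} {T'} (sym e'') p

via-common : ∀ {n T T' V} → OnfIn n T → T ↝ V → T' ↝ V → HasProperOnf T'
via-common onf r r' = hasProperOnf-↝ r' (fromOnfIn (proj₂ (onfIn-↝ onf r)))

_⇒_ : Proc → Proc → Set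
P ⇒ P' = μ P →o μ P'

μ-injective : ∀ {P Q} → μ P ≡ μ Q → P ≡ Q
μ-injective refl = refl

⇒-sub : ∀ {P P'} σ → P ⇒ P' → Σ Term λ U → (μ (subP σ P) →o U) × U ≈ μ (subP σ P')
⇒-sub {P} σ (outer {P = Q} {π = π} e) =
  μ (subP (single (canS (subS σ π))) (canP (subP (liftSub σ) Q))) , outer instance-redex , same
  where
  instance-redex : canT (μ (subP σ P)) ≡ μ (μ (canP (subP (liftSub σ) Q)) ⋆ canS (subS σ π))
  instance-redex = cong μ (trans (sym (canP-sub-can σ P)) (cong (λ z → canP (subP σ z)) (μ-injective e)))
  same : canT (μ (subP (single (canS (subS σ π))) (canP (subP (liftSub σ) Q))))
       ≡ canT (μ (subP σ (subP (single π) Q)))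
  same = cong μ (trans (canP-sub-can _ (subP (liftSub σ) Q))
           (trans (canP-sameCan (λ { zero → canS-idem (subS σ π) ; (suc n) → refl }) (subP (liftSub σ) Q))
             (cong canP (sym (subP-single σ π Q)))))

⇒*-sub : ∀ {P P'} σ → Star _⇒_ P P' → μ (subP σ P) ↝ μ (subP σ P')
⇒*-sub σ ε = ↝-refl refl
⇒*-sub σ (s ◅ ss) with ⇒-sub σ s
... | U , s' , e = ↝-trans (reach (s' ◅ ε) e) (⇒*-sub σ ss)

data HeadRun (G : Proc) (σ : ℕ → Stack) : Set where
  head-run : ∀ {G' τ ρ n} → Star _⇒_ G G' → canP G' ≡ (car τ ⋆ ρ) → Neutral τ →
             OnfIn n (μ (subP σ G')) → HeadRun G σ

-- If the σ-instance of G reaches a proper onf, then G itself runs symbolically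
-- to a neutral head: every μ-redex of G is also a redex of its instance.
mutual
  headRun : ∀ n G σ → OnfIn n (μ (subP σ G)) → HeadRun G σ
  headRun n (t ⋆ ρ) σ onf = headRun-at n t ρ σ onf (canT t) (canT-canonical t) refl

  headRun-at : ∀ n t ρ σ → OnfIn n (μ (subP σ (t ⋆ ρ))) →
               ∀ h → CanTerm h → canT t ≡ h → HeadRun (t ⋆ ρ) σ
  headRun-at n t ρ σ onf .(car _) (can-car ne) eq = head-run ε (cong (_⋆ canS ρ) eq) ne onf
  headRun-at n t ρ σ onf (μ Q) can-μ eq with ⇒-sub σ redex
    where
    redex : (t ⋆ ρ) ⇒ subP (single (canS ρ)) Q
    redex = outer (cong (λ z → μ (z ⋆ canS ρ)) eq)
  headRun-at zero t ρ σ (done p) (μ Q) can-μ eq | U , s , e = ⊥-elim (proper-irreducible p s)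
  headRun-at (suc m) t ρ σ (step s' onf) (μ Q) can-μ eq | U , s , e with →o-deterministic s s'
  ... | refl with headRun m (subP (single (canS ρ)) Q) σ (onfIn-resp-≈ e onf)
  ... | head-run run hd ne onf' = head-run (outer (cong (λ z → μ (z ⋆ canS ρ)) eq) ◅ run) hd ne onf'

-- Slot layout: var 0 is the binder of the head context, var 1 and var 2 are the
-- slots s₁, s₂, and the other variables are shifted past the slots.
skipSlots : ℕ → ℕ
skipSlots zero    = zero
skipSlots (suc n) = suc (suc (suc n))

Gen : Stack → Proc
Gen π = car (renS skipSlots π) ⋆ car (var 1) ∷ car (var 2) ∷ renS skipSlots π

slots : Term → Term → ℕ → Stack
slots a b zero                = var zero
slots a b (suc zero)          = a ∷ nil
slots a b (suc (suc zero))    = b ∷ nil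
slots a b (suc (suc (suc n))) = var (suc n)

slots-skipSlots : ∀ a b π → subS (slots a b) (renS skipSlots π) ≡ π
slots-skipSlots a b π = trans (subS-renS (slots a b) skipSlots π)
  (trans (subS-cong (λ { zero → refl ; (suc n) → refl }) π) (subS-id π))

Gen-slots : ∀ a b π → μ (subP (slots a b) (Gen π)) ≈ μ (car π ⋆ a ∷ b ∷ π)
Gen-slots a b π =
  cong (λ p → canT (μ (car p ⋆ car (a ∷ nil) ∷ car (b ∷ nil) ∷ p))) (slots-skipSlots a b π)

instU : Stack → Term
instU π = subT (single π) (Uat 1)

instB : Term → Stack → Term
instB X π = subT (single π) (μ (car (var 1) ⋆ Uat 2 ∷ X ∷ var 1))

-- What U in head position reduces to; it does not involve the argument of W.
Ω : Stack → Term
Ω π = μ (car π ⋆ π)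

firstSlots : Term → Stack → ℕ → Stack
firstSlots X π = slots (instB X π) (instU π)

-- Once B_X has fired against the stack ρ, the argument of W occupies slot s₂.
argument : Term → Stack → Stack → Term
argument X π ρ = subT (single ρ) (subT (liftSub (single π)) X)

secondSlots : Term → Stack → Stack → ℕ → Stack
secondSlots X π ρ = slots (instU π) (argument X π (canS (subS (firstSlots X π) ρ)))

slot-fires : ∀ σ {G x ρ M Q} → canP G ≡ (car (var x) ⋆ ρ) → σ x ≡ M ∷ nil → canT M ≡ μ Q →
  μ (subP σ G) →o μ (subP (single (canS (subS σ ρ))) Q)
slot-fires σ {G} {ρ = ρ} hd sx cm = outer (cong μ (trans (sym (canP-sub-can σ G))
  (trans (cong (λ z → canP (subP σ z)) hd)
    (trans (cong (λ z → carC (canS z) ⋆ canS (subS σ ρ)) sx)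
      (cong (_⋆ canS (subS σ ρ)) cm)))))

U-fires : ∀ σ {G x ρ} π → canP G ≡ (car (var x) ⋆ ρ) → σ x ≡ instU π ∷ nil → μ (subP σ G) ↝ Ω π
U-fires σ {ρ = ρ} π hd sx = reach (slot-fires σ hd sx refl ◅ ε)
  (cong μ (trans (canP-sub-can (single ρ') (car (renS suc π) ⋆ renS suc π))
                 (cong (λ p → canP (car p ⋆ p)) (single-weaken ρ' π))))
  where ρ' = canS (subS σ ρ)

-- The copy of U inside B_X is U again after B_X fires.
lifted-single-weaken² : ∀ ρ π → subS (liftSub (single ρ)) (renS suc (renS suc π)) ≡ renS suc π
lifted-single-weaken² ρ π =
  trans (subS-renS _ suc (renS suc π)) (trans (subS-renS _ suc π) (subS-by-vars suc π))

B-fires : ∀ X π {G ρ} → canP G ≡ (car (var 1) ⋆ ρ) →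
  μ (subP (firstSlots X π) G) ↝ μ (subP (secondSlots X π ρ) (Gen π))
B-fires X π {ρ = ρ} hd = reach (slot-fires (firstSlots X π) hd refl refl ◅ ε)
  (trans (cong μ (canP-sub-can (single ρ') body))
    (trans (cong (λ z → canT (μ z)) fired) (sym (Gen-slots (instU π) X' π))))
  where
  ρ'   = canS (subS (firstSlots X π) ρ)
  X'   = argument X π ρ'
  body = subP (liftSub (single π)) (car (var 1) ⋆ Uat 2 ∷ X ∷ var 1)
  fired : subP (single ρ') body ≡ (car π ⋆ instU π ∷ X' ∷ π)
  fired = cong₂ (λ p q → car p ⋆ μ (car q ⋆ q) ∷ X' ∷ p)
                (single-weaken ρ' π) (lifted-single-weaken² ρ' π)

-- If the run of Gen ends on slot s₁, replaying it after B_X has fired ends on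
-- slot s₁ again, which now holds U.
second-pass : ∀ X π {G ρ} → Star _⇒_ (Gen π) G → canP G ≡ (car (var 1) ⋆ ρ) →
  μ (subP (firstSlots X π) G) ↝ Ω π
second-pass X π {ρ = ρ} run hd = ↝-trans (B-fires X π hd)
  (↝-trans (⇒*-sub (secondSlots X π ρ) run) (U-fires (secondSlots X π ρ) π hd refl))

subS-cdr^ : ∀ σ k v → subS σ (cdr^ k v) ≡ cdr^ k (subS σ v)
subS-cdr^ σ zero    v = refl
subS-cdr^ σ (suc k) v = cong cdr (subS-cdr^ σ k v)

carC-canS-neutral : ∀ {τ} → Neutral τ → carC (canS τ) ≡ car τ
carC-canS-neutral ne = trans (cong carC (canS-neutral ne)) (carC-neutral ne)

head-nil : ∀ σ k → carC (canS (subS σ (cdr^ k nil))) ≡ car (cdr^ k nil)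
head-nil σ k = trans (cong (λ z → carC (canS z)) (subS-cdr^ σ k nil))
                     (carC-canS-neutral (neutral-cdr^ k ne-nil))

head-var : ∀ σ k {x y} → σ x ≡ var y → carC (canS (subS σ (cdr^ k (var x)))) ≡ car (cdr^ k (var y))
head-var σ k {x} {y} sx =
  trans (cong (λ z → carC (canS z)) (trans (subS-cdr^ σ k (var x)) (cong (cdr^ k) sx)))
        (carC-canS-neutral (neutral-cdr^ k (ne-var y)))

head-singleton : ∀ σ k {x M} → σ x ≡ M ∷ nil →
  carC (canS (subS σ (cdr^ (suc k) (var x)))) ≡ car (cdr^ k nil)
head-singleton σ k {x} {M} sx =
  trans (cong (λ z → carC (canS z)) (trans (subS-cdr^ σ (suc k) (var x)) (cong (cdr^ (suc k)) sx)))
    (trans (cong carC (canS-cdr^-cons k M nil)) (carC-canS-neutral (neutral-cdr^ k ne-nil)))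

instance-head : ∀ σ {G τ ρ} → canP G ≡ (car τ ⋆ ρ) →
  canT (μ (subP σ G)) ≡ μ (carC (canS (subS σ τ)) ⋆ canS (subS σ ρ))
instance-head σ {G} hd = cong μ (trans (sym (canP-sub-can σ G)) (cong (λ z → canP (subP σ z)) hd))

proper-head : ∀ σ {G τ ρ} k y → canP G ≡ (car τ ⋆ ρ) →
  carC (canS (subS σ τ)) ≡ car (cdr^ k (var y)) → HasProperOnf (μ (subP σ G))
proper-head σ k y hd h = _ , ε , k , y , _ , trans (instance-head σ hd) (cong (λ z → μ (z ⋆ _)) h)

cdr^-var≢nil : ∀ n x k → cdr^ n (var x) ≢ cdr^ k nil
cdr^-var≢nil zero    x zero    ()
cdr^-var≢nil zero    x (suc k) ()
cdr^-var≢nil (suc n) x zero    ()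
cdr^-var≢nil (suc n) x (suc k) e = cdr^-var≢nil n x k (cdr-injective e)
  where
  cdr-injective : ∀ {a b} → cdr a ≡ cdr b → a ≡ b
  cdr-injective refl = refl

head-stack : ∀ {a b c d} → μ (car a ⋆ c) ≡ μ (car b ⋆ d) → a ≡ b
head-stack refl = refl

improper-head : ∀ σ {G τ ρ} k → canP G ≡ (car τ ⋆ ρ) →
  carC (canS (subS σ τ)) ≡ car (cdr^ k nil) → ∀ {n} → OnfIn n (μ (subP σ G)) → ⊥
improper-head σ k hd h onf with trans (instance-head σ hd) (cong (λ z → μ (z ⋆ _)) h) | onf
... | e | done (n , x , _ , e') = cdr^-var≢nil n x k (head-stack (trans (sym e') e))
... | e | step (outer e') _ with trans (sym e) e'
... | ()

-- Case analysis on the final head of a symbolic run of Gen: either it gives an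
-- onf that does not depend on the argument of W, or both instances reach Ω(π).
by-final-head : ∀ X Y π {G τ ρ n} → Star _⇒_ (Gen π) G → canP G ≡ (car τ ⋆ ρ) → NeutralView τ →
  OnfIn n (μ (subP (firstSlots X π) G)) → HasProperOnf (μ (subP (firstSlots Y π) G))
by-final-head X Y π run hd (cdrs-nil k) onf =
  ⊥-elim (improper-head (firstSlots X π) k hd (head-nil _ k) onf)
by-final-head X Y π run hd (cdrs-var k zero) onf =
  proper-head (firstSlots Y π) k zero hd (head-var _ k refl)
by-final-head X Y π run hd (cdrs-var zero 1) onf =
  via-common onf (second-pass X π run hd) (second-pass Y π run hd)
by-final-head X Y π run hd (cdrs-var (suc k) 1) onf =
  ⊥-elim (improper-head (firstSlots X π) k hd (head-singleton _ k refl) onf)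
by-final-head X Y π run hd (cdrs-var zero 2) onf =
  via-common onf (U-fires (firstSlots X π) π hd refl) (U-fires (firstSlots Y π) π hd refl)
by-final-head X Y π run hd (cdrs-var (suc k) 2) onf =
  ⊥-elim (improper-head (firstSlots X π) k hd (head-singleton _ k refl) onf)
by-final-head X Y π run hd (cdrs-var k (suc (suc (suc y)))) onf =
  proper-head (firstSlots Y π) k (suc y) hd (head-var _ k refl)

slots-transfer : ∀ X Y π {n} → OnfIn n (μ (subP (firstSlots X π) (Gen π))) →
  HasProperOnf (μ (subP (firstSlots Y π) (Gen π)))
slots-transfer X Y π onf with headRun _ (Gen π) (firstSlots X π) onf
... | head-run run hd ne onf' =
  hasProperOnf-↝ (⇒*-sub (firstSlots Y π) run) (by-final-head X Y π run hd (neutralView ne) onf')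

Wbody : Term → Proc
Wbody X = car (var 0) ⋆ μ (car (var 1) ⋆ Uat 2 ∷ X ∷ var 1) ∷ Uat 1 ∷ var 0

W-step : ∀ X π → μ (W X ⋆ π) →o μ (subP (single (canS π)) (Wbody (canT X)))
W-step X π = outer refl

W-step-Gen : ∀ X π → μ (subP (single π) (Wbody X)) ≈ μ (subP (firstSlots X π) (Gen π))
W-step-Gen X π = sym (Gen-slots (instB X π) (instU π) π)

root-transfer : ∀ X Y π {n} → OnfIn n (μ (W X ⋆ π)) → HasProperOnf (μ (W Y ⋆ π))
root-transfer X Y π onf with onfIn-step onf (W-step X π)
... | _ , onf' =
  hasProperOnf-↝ (↝-trans (↝-step (W-step Y π)) (↝-refl (W-step-Gen (canT Y) (canS π))))
    (slots-transfer (canT X) (canT Y) (canS π) (onfIn-resp-≈ (W-step-Gen (canT X) (canS π)) onf'))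

canCtx : HCtx → HCtx
canCtx hole     = hole
canCtx (mu C π) = mu (canCtx C) (canS π)

canT-plug : ∀ C M → canT (plug C M) ≡ plug (canCtx C) (canT M)
canT-plug hole     M = refl
canT-plug (mu C π) M = cong (λ z → μ (z ⋆ canS π)) (canT-plug C M)

subCtx : (ℕ → Stack) → HCtx → HCtx
subCtx σ hole     = hole
subCtx σ (mu C π) = mu (subCtx (liftSub σ) C) (subS (liftSub σ) π)

-- The substitution reaching the hole, which lies under the binders of C.
holeSub : HCtx → (ℕ → Stack) → ℕ → Stack
holeSub hole     σ = σ
holeSub (mu C π) σ = holeSub C (liftSub σ)

subT-plug : ∀ C σ M → subT σ (plug C M) ≡ plug (subCtx σ C) (subT (holeSub C σ) M)
subT-plug hole     σ M = refl
subT-plug (mu C π) σ M = cong (λ z → μ (z ⋆ subS (liftSub σ) π)) (subT-plug C (liftSub σ) M)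

-- A head context of depth ≥ 2 makes the first outer step, leaving a shallower
-- head context around W[X'] for an instance X' of X.
ctxAfter : HCtx → Stack → Stack → HCtx
ctxAfter C π' π = mu (subCtx (single (canS π)) (canCtx C)) (subS (single (canS π)) (canS π'))

argAfter : HCtx → Stack → Term → Term
argAfter C π X = subT (liftSub (liftSub (holeSub (canCtx C) (single (canS π))))) (canT X)

ctx-step : ∀ C π' π X → plug (mu (mu C π') π) (W X) →o plug (ctxAfter C π' π) (W (argAfter C π X))
ctx-step C π' π X =
  subst (λ z → plug (mu (mu C π') π) (W X) →o μ (z ⋆ subS (single (canS π)) (canS π')))
        (subT-plug (canCtx C) (single (canS π)) (W (canT X)))
        (outer (cong (λ z → μ (μ (z ⋆ canS π') ⋆ canS π)) (canT-plug C (W X))))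

ctx-transfer : ∀ C X Y {n} → OnfIn n (plug C (W X)) → HasProperOnf (plug C (W Y))
ctx-transfer hole               X Y onf = W Y , ε , 0 , 0 , _ , refl
ctx-transfer (mu hole π)        X Y onf = root-transfer X Y π onf
ctx-transfer (mu (mu C π') π) X Y (done p) = ⊥-elim (proper-irreducible p (ctx-step C π' π X))
ctx-transfer (mu (mu C π') π) X Y (step s onf) with →o-deterministic s (ctx-step C π' π X)
... | refl with ctx-transfer (ctxAfter C π' π) (argAfter C π X) (argAfter C π Y) onf
... | T , ss , p = T , ctx-step C π' π Y ◅ ss , p

theorem2 : (M N : Term) → W M ≃op W N
theorem2 M N C = mk⇔ (transfer M N) (transfer N M)
  where
  transfer : ∀ X Y → HasProperOnf (plug C (W X)) → HasProperOnf (plug C (W Y))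
  transfer X Y h = ctx-transfer C X Y (proj₂ (toOnfIn h))
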